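{- Let $d>1$ be a square-free integer, $F=\mathbb{Q}(\sqrt d)$, $E=\mathbb{Q}(\sqrt d,i)$, and let $\varepsilon$ be an algebraic integer of $F$ with conjugate $\bar\varepsilon$. Let $a'$ be a nonzero integer and $p>2$ a prime with $p\nmid a'd$ and $\left(\frac dp\right)=\left(\frac{ -1}p\right)=1$. Let $X,Y,U,V$ be rational numbers with denominators prime to $p$ such that $a'p=X^2+dY^2=U^2+V^2$. Let $\mathfrak P$ be a prime of $E$ above $p$ such that $X-Y\sqrt d\,i\equiv 0$ and $U-Vi\equiv 0$ modulo $\mathfrak P$ (in the localization of the ring of integers of $E$ at $\mathfrak P$). Suppose $\eta,\eta'\in\mu_4$ satisfy $\varepsilon^{\frac{p-1}4}\equiv\eta\pmod{\mathfrak P}$ and $\bar\varepsilon^{\frac{p-1}4}\equiv\eta'\pmod{\mathfrak P}$. Let $\alpha,\beta\in\{\pm1\}$. Then, modulo $p$: (i) if $\eta=\alpha$, $\eta'=\beta$, then $\varepsilon^{\frac{p-1}4}\equiv\frac12(\alpha+\beta)+\frac12\left(\frac{YV}{XU}\beta-\frac{YV}{XU}\alpha\right)\sqrt d$; (ii) if $\eta=\alpha$, $\eta'=\beta i$, then $\varepsilon^{\frac{p-1}4}\equiv\frac12\left(\alpha-\frac VU\beta\right)+\frac12\left(\frac YX\beta-\frac{YV}{XU}\alpha\right)\sqrt d$; (iii) if $\eta=\alpha i$, $\eta'=\beta$, then $\varepsilon^{\frac{p-1}4}\equiv\frac12\left(\beta-\frac VU\alpha\right)+\frac12\left(\frac{YV}{XU}\beta-\frac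 YX\alpha\right)\sqrt d$; (iv) if $\eta=\alpha i$, $\eta'=\beta i$, then $\varepsilon^{\frac{p-1}4}\equiv\frac12\left(-\frac VU\alpha-\frac VU\beta\right)+\frac12\left(\frac YX\beta-\frac YX\alpha\right)\sqrt d$.
   Context: $i=\sqrt{ -1}$, $\mu_4=\{\pm1,\pm i\}$. Congruences modulo $p$ are between elements of $F$ that are integral at $p$; fractions with numerator and denominator integral at $p$ and denominator a $p$-adic unit are interpreted modulo $p$ in the usual way. -}

module Defs where

open import Data.Nat as ℕ using (ℕ; _∸_)
open import Data.Nat.Primality using (Prime)
open import Data.Nat.Divisibility as ℕD using ()
open import Data.Integer as ℤ using (ℤ; +_)
open import Data.Integer.Divisibility as ℤD using ()
open import Data.Rational as ℚ using (ℚ; ↥_; ↧ₙ_; 0ℚ; 1ℚ; _+_; _*_; _-_; -_; _÷_; ≢-nonZero; _≟_)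
open import Relation.Nullary using (¬_; yes; no)
open import Relation.Binary.PropositionalEquality using (_≡_)
open import Data.Product using (∃; _×_)
open import Data.Sum using (_⊎_)

IsInt : ℚ → Set
IsInt q = ↧ₙ q ≡ 1

PIntegral : ℕ → ℚ → Set
PIntegral p q = ¬ (p ℕD.∣ (↧ₙ q))

-- congruence modulo p of rationals (intended for p-integral arguments):
-- p divides the numerator of q - r (in lowest terms)
_≡_[modℚ_] : ℚ → ℚ → ℕ → Set
q ≡ r [modℚ p ] = (+ p) ℤD.∣ (↥ (q - r))

SquareFree : ℕ → Set
SquareFree d = ∀ n → (n ℕ.* n) ℕD.∣ d → n ≡ 1

LegendreOne : ℤ → ℕ → Set
LegendreOne a p = ¬ ((+ p) ℤD.∣ a) × ∃ λ s → (+ p) ℤD.∣ (s ℤ.* s ℤ.- a)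

ι : ℤ → ℚ
ι z = z ℚ./ 1

-- total division: equals q / r when r ≠ 0 (and 0 otherwise; never used
-- in that case under the hypotheses of the lemma)
_⊘_ : ℚ → ℚ → ℚ
q ⊘ r with r ≟ 0ℚ
... | yes _ = 0ℚ
... | no r≢0 = _÷_ q r {{≢-nonZero r≢0}}

-- Elements of E = ℚ(√d, i), coordinates w.r.t. basis 1, √d, i, √d·i
record E : Set where
  constructor mkE
  field
    c₁ c√d cᵢ c√dᵢ : ℚ
open E public

module Field (d : ℕ) where
  δ : ℚ
  δ = ι (+ d)

  _·_ : E → E → E
  mkE a1 b1 c1 e1 · mkE a2 b2 c2 e2 =
    mkE (a1 * a2 + δ * b1 * b2 - c1 * c2 - δ * e1 * e2)
        (a1 * b2 + b1 * a2 - c1 * e2 - e1 * c2)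
        (a1 * c2 + c1 * a2 + δ * b1 * e2 + δ * e1 * b2)
        (a1 * e2 + e1 * a2 + b1 * c2 + c1 * b2)

  one : E
  one = mkE 1ℚ 0ℚ 0ℚ 0ℚ

  _^_ : E → ℕ → E
  x ^ ℕ.zero = one
  x ^ ℕ.suc n = x · (x ^ n)

  fromF : ℚ → ℚ → E
  fromF x y = mkE x y 0ℚ 0ℚ

  -- algebraic integer of F: x + y√d whose minimal polynomial
  -- T² - 2x T + (x² - d y²) has integer coefficients
  IsAlgIntF : ℚ → ℚ → Set
  IsAlgIntF x y = IsInt (x + x) × IsInt (x * x - δ * y * y)

  -- congruence modulo p of p-integral elements (coordinatewise;
  -- since p ∤ 2d, the p-localised ring of integers has basis 1,√d,i,√di)
  _≡ₚ_[mod_] : E → E → ℕ → Set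
  mkE a1 b1 c1 e1 ≡ₚ mkE a2 b2 c2 e2 [mod p ] =
    (a1 ≡ a2 [modℚ p ]) × (b1 ≡ b2 [modℚ p ]) × (c1 ≡ c2 [modℚ p ]) × (e1 ≡ e2 [modℚ p ])

  -- A prime 𝔓 of E above p (p ∤ 2d, (d/p) = (-1/p) = 1, so p splits
  -- completely and 𝔓 has residue field 𝔽_p) is determined by the images
  -- s, t ∈ ℤ/p of √d and i: s² ≡ d, t² ≡ -1 (mod p).
  record PrimeAbove (p : ℕ) : Set where
    constructor prime𝔓
    field
      s t : ℤ
      s²≡d : (+ p) ℤD.∣ (s ℤ.* s ℤ.- + d)
      t²≡-1 : (+ p) ℤD.∣ (t ℤ.* t ℤ.+ + 1)

  _≡_[mod𝔓_] : E → E → {p : ℕ} → PrimeAbove p → Set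
  _≡_[mod𝔓_] (mkE a1 b1 c1 e1) (mkE a2 b2 c2 e2) {p} (prime𝔓 s t _ _) =
    ((a1 - a2) + (b1 - b2) * ι s + (c1 - c2) * ι t + (e1 - e2) * ι s * ι t) ≡ 0ℚ [modℚ p ]

  Inμ₄ : E → Set
  Inμ₄ η = (η ≡ mkE 1ℚ 0ℚ 0ℚ 0ℚ) ⊎ (η ≡ mkE (- 1ℚ) 0ℚ 0ℚ 0ℚ)
         ⊎ (η ≡ mkE 0ℚ 0ℚ 1ℚ 0ℚ) ⊎ (η ≡ mkE 0ℚ 0ℚ (- 1ℚ) 0ℚ)

  _·i : ℚ → E
  r ·i = mkE 0ℚ 0ℚ r 0ℚ

Sign : ℚ → Set
Sign α = (α ≡ 1ℚ) ⊎ (α ≡ - 1ℚ)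

-- As p ∤ 2d splits completely in E, reduction modulo 𝔓 is the ring map √d ↦ s, i ↦ t
-- into 𝔽_p, where s² ≡ d and t² ≡ −1 (mod p); all of it is computed in ℚ, congruence
-- modulo p of p-integral rationals standing in for equality in 𝔽_p.
-- Write εᵏ = a + b√d with k = (p − 1)/4; then ε̄ᵏ = a − b√d, so a + bs ≡ η and a − bs ≡ η′.
-- X, Y, U, V are prime to p (otherwise p² ∣ a′p), and X ≡ Y s t, U ≡ V t give
-- t·(V/U) ≡ 1 and s t·(Y/X) ≡ 1, hence V/U ≡ −t, s·(Y/X) ≡ −t and s·r ≡ t² ≡ −1 for
-- r = YV/XU. So a ≡ (η + η′)/2 and b ≡ (η − η′)/(2s) ≡ (r η′ − r η)/2, and the four cases
-- follow by rewriting the image t of i as −V/U, and r t as Y/X.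

{-# OPTIONS --safe #-}
module Submission where

open import Defs
open import Data.Nat as ℕ using (ℕ; zero; suc; _∸_; _/_; _>_)
open import Data.Nat.Divisibility as ℕD using ()
open import Data.Nat.Primality using (Prime; euclidsLemma; ¬prime[1]; prime⇒nonZero)
import Data.Nat.Properties as ℕP
import Data.Nat.Coprimality as Coprimality
open import Data.Integer as ℤ using (ℤ; +_)
import Data.Integer.Properties as ℤP
open import Data.Integer.Divisibility as ℤD using ()
import Data.Integer.Divisibility.Signed as ℤS
open import Data.Rational as ℚ using (ℚ; ↥_; ↧_; ↧ₙ_; 0ℚ; 1ℚ; ½; _+_; _*_; _-_; -_; 1/_; toℚᵘ)
import Data.Rational.Properties as ℚP
open import Data.Rational.Solver using (module +-*-Solver)
open import Data.Rational.Unnormalised as ℚᵘ using (ℚᵘ; mkℚᵘ; *≡*; _≃_)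
import Data.Rational.Unnormalised.Properties as ℚᵘP
open import Data.Product using (_×_; _,_; ∃; proj₁; proj₂)
open import Data.Sum using (_⊎_; inj₁; inj₂; fromInj₂; [_,_]′)
open import Function using (_∘_)
open import Data.Empty using (⊥-elim)
open import Level using (0ℓ)
open import Relation.Binary.Bundles using (Setoid)
import Relation.Binary.Reasoning.Setoid as SetoidReasoning
open import Relation.Binary.PropositionalEquality
open import Relation.Nullary using (¬_; yes; no)

open +-*-Solver using (solve; _:=_; _:+_; _:*_; _:-_; :-_; con)

⊘-inverseʳ : ∀ q {r} → r ≢ 0ℚ → (q ⊘ r) * r ≡ q
⊘-inverseʳ q {r} r≢0 with r ℚ.≟ 0ℚ
... | yes r≡0 = ⊥-elim (r≢0 r≡0)
... | no r≢0′ = begin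
  q * 1/ r * r     ≡⟨ ℚP.*-assoc q (1/ r) r ⟩
  q * (1/ r * r)   ≡⟨ cong (q *_) (ℚP.*-inverseˡ r) ⟩
  q * 1ℚ           ≡⟨ ℚP.*-identityʳ q ⟩
  q                ∎
  where open ≡-Reasoning; instance _ = ℚ.≢-nonZero r≢0′

*-⊘-cancelʳ : ∀ q {r} → r ≢ 0ℚ → (q * r) ⊘ r ≡ q
*-⊘-cancelʳ q {r} r≢0 with r ℚ.≟ 0ℚ
... | yes r≡0 = ⊥-elim (r≢0 r≡0)
... | no r≢0′ = begin
  q * r * 1/ r     ≡⟨ ℚP.*-assoc q r (1/ r) ⟩
  q * (r * 1/ r)   ≡⟨ cong (q *_) (ℚP.*-inverseʳ r) ⟩
  q * 1ℚ           ≡⟨ ℚP.*-identityʳ q ⟩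
  q                ∎
  where open ≡-Reasoning; instance _ = ℚ.≢-nonZero r≢0′

⊘-unique : ∀ {q r z} → r ≢ 0ℚ → z * r ≡ q → z ≡ q ⊘ r
⊘-unique {r = r} {z} r≢0 zr≡q = trans (sym (*-⊘-cancelʳ z r≢0)) (cong (_⊘ r) zr≡q)

*-cancelʳ-≡ : ∀ {q q′} r → r ≢ 0ℚ → q * r ≡ q′ * r → q ≡ q′
*-cancelʳ-≡ {q′ = q′} r r≢0 eq = trans (⊘-unique r≢0 eq) (*-⊘-cancelʳ q′ r≢0)

toℚᵘ-ι : ∀ z → toℚᵘ (ι z) ≃ mkℚᵘ z 0
toℚᵘ-ι z = ℚP.toℚᵘ-fromℚᵘ (mkℚᵘ z 0)

ι-* : ∀ m n → ι (m ℤ.* n) ≡ ι m * ι n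
ι-* m n = ℚP.toℚᵘ-injective (begin
  toℚᵘ (ι (m ℤ.* n))          ≈⟨ toℚᵘ-ι (m ℤ.* n) ⟩
  mkℚᵘ m 0 ℚᵘ.* mkℚᵘ n 0      ≈⟨ ℚᵘP.*-cong (toℚᵘ-ι m) (toℚᵘ-ι n) ⟨
  toℚᵘ (ι m) ℚᵘ.* toℚᵘ (ι n)  ≈⟨ ℚP.toℚᵘ-homo-* (ι m) (ι n) ⟨
  toℚᵘ (ι m * ι n)            ∎)
  where open ℚᵘP.≃-Reasoning

ι-+ : ∀ m n → ι (m ℤ.+ n) ≡ ι m + ι n
ι-+ m n = ℚP.toℚᵘ-injective (begin
  toℚᵘ (ι (m ℤ.+ n))          ≈⟨ toℚᵘ-ι (m ℤ.+ n) ⟩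
  mkℚᵘ (m ℤ.+ n) 0            ≈⟨ *≡* (cong (ℤ._* + 1) (cong₂ ℤ._+_ (sym (ℤP.*-identityʳ m))
                                                                  (sym (ℤP.*-identityʳ n)))) ⟩
  mkℚᵘ m 0 ℚᵘ.+ mkℚᵘ n 0      ≈⟨ ℚᵘP.+-cong (toℚᵘ-ι m) (toℚᵘ-ι n) ⟨
  toℚᵘ (ι m) ℚᵘ.+ toℚᵘ (ι n)  ≈⟨ ℚP.toℚᵘ-homo-+ (ι m) (ι n) ⟨
  toℚᵘ (ι m + ι n)            ∎)
  where open ℚᵘP.≃-Reasoning

ι-neg : ∀ m → ι (ℤ.- m) ≡ - ι m
ι-neg m = ℚP.toℚᵘ-injective (begin
  toℚᵘ (ι (ℤ.- m))     ≈⟨ toℚᵘ-ι (ℤ.- m) ⟩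
  ℚᵘ.- mkℚᵘ m 0        ≈⟨ ℚᵘP.-‿cong (toℚᵘ-ι m) ⟨
  ℚᵘ.- toℚᵘ (ι m)      ≈⟨ ℚP.toℚᵘ-homo‿- (ι m) ⟨
  toℚᵘ (- ι m)         ∎)
  where open ℚᵘP.≃-Reasoning

module Localisation {p : ℕ} (p-prime : Prime p) where

  record Integral (q : ℚ) : Set where
    constructor integral
    field p∤↧ : ¬ p ℕD.∣ ↧ₙ q

  record Divisible (q : ℚ) : Set where
    constructor divisible
    field p∣↥ : + p ℤS.∣ ↥ q

  open Integral public
  open Divisible public

  Unit : ℚ → Set
  Unit q = Integral q × ¬ Divisible q

  p∤1 : ¬ p ℕD.∣ 1
  p∤1 p∣1 = ¬prime[1] (subst Prime (ℕD.∣1⇒≡1 p∣1) p-prime)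

  private
    euclid : ∀ {m n} → + p ℤS.∣ m ℤ.* n → + p ℤS.∣ m ⊎ + p ℤS.∣ n
    euclid {m} {n} p∣mn
      with euclidsLemma ℤ.∣ m ∣ ℤ.∣ n ∣ p-prime (subst (p ℕD.∣_) (ℤP.abs-* m n) (ℤS.∣⇒∣ᵤ p∣mn))
    ... | inj₁ p∣m = inj₁ (ℤS.∣ᵤ⇒∣ p∣m)
    ... | inj₂ p∣n = inj₂ (ℤS.∣ᵤ⇒∣ p∣n)

    ∤-* : ∀ {m n} → ¬ p ℕD.∣ m → ¬ p ℕD.∣ n → ¬ p ℕD.∣ m ℕ.* n
    ∤-* {m} {n} p∤m p∤n p∣mn with euclidsLemma m n p-prime p∣mn
    ... | inj₁ p∣m = p∤m p∣m
    ... | inj₂ p∣n = p∤n p∣n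

    cross : ∀ {q u} → toℚᵘ q ≃ u → ↥ q ℤ.* ℚᵘ.↧ u ≡ ℚᵘ.↥ u ℤ.* ↧ q
    cross {q@record{}} (*≡* eq) = eq

    lowest-terms : ∀ q → + p ℤS.∣ ↥ q → ¬ p ℕD.∣ ↧ₙ q
    lowest-terms (ℚ.mkℚ _ _ coprime) p∣↥q p∣↧q =
      p∤1 (subst (p ℕD.∣_) (Coprimality.recompute coprime (ℤS.∣⇒∣ᵤ p∣↥q , p∣↧q)) ℕD.∣-refl)

  divisible⇒integral : ∀ {q} → Divisible q → Integral q
  divisible⇒integral {q} (divisible p∣↥q) = integral (lowest-terms q p∣↥q)

  -- The p-adic properties of q can be read off any fraction u representing it
  -- whose denominator is prime to p.
  module _ {q : ℚ} {u : ℚᵘ} (q≃u : toℚᵘ q ≃ u) (p∤↧u : ¬ p ℕD.∣ ℚᵘ.↧ₙ u) where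

    integral-≃ : Integral q
    integral-≃ = integral p∤↧q
      where
      p∤↧q : ¬ p ℕD.∣ ↧ₙ q
      p∤↧q p∣↧q
        with euclid (subst (+ p ℤS.∣_) (sym (cross q≃u)) (ℤS.∣n⇒∣m*n (ℚᵘ.↥ u) (ℤS.∣ᵤ⇒∣ p∣↧q)))
      ... | inj₁ p∣↥q = lowest-terms q p∣↥q p∣↧q
      ... | inj₂ p∣↧u = p∤↧u (ℤS.∣⇒∣ᵤ p∣↧u)

    divisible-≃⁺ : Divisible q → + p ℤS.∣ ℚᵘ.↥ u
    divisible-≃⁺ (divisible p∣↥q)
      with euclid (subst (+ p ℤS.∣_) (cross q≃u) (ℤS.∣m⇒∣m*n (ℚᵘ.↧ u) p∣↥q))
    ... | inj₁ p∣↥u = p∣↥u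
    ... | inj₂ p∣↧q = ⊥-elim (p∤↧ integral-≃ (ℤS.∣⇒∣ᵤ p∣↧q))

    divisible-≃⁻ : + p ℤS.∣ ℚᵘ.↥ u → Divisible q
    divisible-≃⁻ p∣↥u
      with euclid (subst (+ p ℤS.∣_) (sym (cross q≃u)) (ℤS.∣m⇒∣m*n (↧ q) p∣↥u))
    ... | inj₁ p∣↥q = divisible p∣↥q
    ... | inj₂ p∣↧u = ⊥-elim (p∤↧u (ℤS.∣⇒∣ᵤ p∣↧u))

  integral-+ : ∀ {q r} → Integral q → Integral r → Integral (q + r)
  integral-+ {q@record{}} {r@record{}} iq ir =
    integral-≃ (ℚP.toℚᵘ-homo-+ q r) (∤-* (p∤↧ iq) (p∤↧ ir))

  integral-* : ∀ {q r} → Integral q → Integral r → Integral (q * r)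
  integral-* {q@record{}} {r@record{}} iq ir =
    integral-≃ (ℚP.toℚᵘ-homo-* q r) (∤-* (p∤↧ iq) (p∤↧ ir))

  integral-neg : ∀ {q} → Integral q → Integral (- q)
  integral-neg {q@record{}} iq = integral-≃ (ℚP.toℚᵘ-homo‿- q) (p∤↧ iq)

  integral-ι : ∀ z → Integral (ι z)
  integral-ι z = integral-≃ (toℚᵘ-ι z) p∤1

  divisible-+ : ∀ {q r} → Divisible q → Divisible r → Divisible (q + r)
  divisible-+ {q@record{}} {r@record{}} dq dr =
    divisible-≃⁻ (ℚP.toℚᵘ-homo-+ q r) (∤-* (p∤↧ (divisible⇒integral dq)) (p∤↧ (divisible⇒integral dr)))
      (ℤS.∣m∣n⇒∣m+n (ℤS.∣m⇒∣m*n (↧ r) (p∣↥ dq)) (ℤS.∣m⇒∣m*n (↧ q) (p∣↥ dr)))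

  divisible-neg : ∀ {q} → Divisible q → Divisible (- q)
  divisible-neg {q@record{}} dq =
    divisible-≃⁻ (ℚP.toℚᵘ-homo‿- q) (p∤↧ (divisible⇒integral dq)) (ℤS.∣m⇒∣-m (p∣↥ dq))

  divisible-*ʳ : ∀ {q r} → Divisible q → Integral r → Divisible (q * r)
  divisible-*ʳ {q@record{}} {r@record{}} dq ir =
    divisible-≃⁻ (ℚP.toℚᵘ-homo-* q r) (∤-* (p∤↧ (divisible⇒integral dq)) (p∤↧ ir))
      (ℤS.∣m⇒∣m*n (↥ r) (p∣↥ dq))

  divisible-*-split : ∀ {q r} → Integral q → Integral r → Divisible (q * r) → Divisible q ⊎ Divisible r
  divisible-*-split {q@record{}} {r@record{}} iq ir dqr
    with euclid (divisible-≃⁺ (ℚP.toℚᵘ-homo-* q r) (∤-* (p∤↧ iq) (p∤↧ ir)) dqr)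
  ... | inj₁ p∣↥q = inj₁ (divisible p∣↥q)
  ... | inj₂ p∣↥r = inj₂ (divisible p∣↥r)

  divisible-ι⁺ : ∀ z → Divisible (ι z) → + p ℤS.∣ z
  divisible-ι⁺ z = divisible-≃⁺ (toℚᵘ-ι z) p∤1

  divisible-ι⁻ : ∀ z → + p ℤS.∣ z → Divisible (ι z)
  divisible-ι⁻ z = divisible-≃⁻ (toℚᵘ-ι z) p∤1

  -- If p divided the denominator of z, the numerator of u * z would have to
  -- absorb it, forcing p ∣ ↥ u.
  integral-cancelˡ : ∀ {u z} → ¬ Divisible u → Integral (u * z) → Integral z
  integral-cancelˡ {u@record{}} {z@record{}} u≉0 iuz = integral p∤↧z
    where
    p∤↧z : ¬ p ℕD.∣ ↧ₙ z
    p∤↧z p∣↧z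
      with euclid (subst (+ p ℤS.∣_) (cross (ℚP.toℚᵘ-homo-* u z))
                    (ℤS.∣n⇒∣m*n (↥ (u * z)) (ℤS.∣n⇒∣m*n (↧ u) (ℤS.∣ᵤ⇒∣ {i = ↧ z} p∣↧z))))
    ... | inj₂ p∣↧uz = p∤↧ iuz (ℤS.∣⇒∣ᵤ p∣↧uz)
    ... | inj₁ p∣↥u↥z with euclid {↥ u} {↥ z} p∣↥u↥z
    ...   | inj₁ p∣↥u = u≉0 (divisible p∣↥u)
    ...   | inj₂ p∣↥z = lowest-terms z p∣↥z p∣↧z

  isInt⇒integral : ∀ {q} → IsInt q → Integral q
  isInt⇒integral ↧q≡1 = integral (p∤1 ∘ subst (p ℕD.∣_) ↧q≡1)

  integral-of-square : ∀ {q} → Integral (q * q) → Integral q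
  integral-of-square {q} iqq with p ℕD.∣? ℤ.∣ ↥ q ∣
  ... | yes p∣↥q = divisible⇒integral (divisible (ℤS.∣ᵤ⇒∣ p∣↥q))
  ... | no  p∤↥q = integral-cancelˡ {u = q} (p∤↥q ∘ ℤS.∣⇒∣ᵤ ∘ p∣↥) iqq

  sign-integral : ∀ {α} → Sign α → Integral α
  sign-integral (inj₁ refl) = integral p∤1
  sign-integral (inj₂ refl) = integral p∤1

  divisible-0 : Divisible 0ℚ
  divisible-0 = divisible (ℤS.divides (+ 0) refl)

  infix 4 _≈_
  record _≈_ (q r : ℚ) : Set where
    constructor from-divisible
    field to-divisible : Divisible (q - r)

  open _≈_ public

  modℚ⇒≈ : ∀ {q r} → q ≡ r [modℚ p ] → q ≈ r
  modℚ⇒≈ q≡r = from-divisible (divisible (ℤS.∣ᵤ⇒∣ q≡r))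

  ≈⇒modℚ : ∀ {q r} → q ≈ r → q ≡ r [modℚ p ]
  ≈⇒modℚ (from-divisible (divisible p∣q-r)) = ℤS.∣⇒∣ᵤ p∣q-r

  private
    divisible⇒≈ : ∀ {d q r} → d ≡ q - r → Divisible d → q ≈ r
    divisible⇒≈ refl = from-divisible

  ≈-reflexive : ∀ {q r} → q ≡ r → q ≈ r
  ≈-reflexive {q} refl = divisible⇒≈ (sym (ℚP.+-inverseʳ q)) divisible-0

  ≈-sym : ∀ {q r} → q ≈ r → r ≈ q
  ≈-sym {q} {r} (from-divisible q-r) =
    divisible⇒≈ (solve 2 (λ q r → :- (q :- r) := r :- q) refl q r) (divisible-neg q-r)

  ≈-trans : ∀ {q r z} → q ≈ r → r ≈ z → q ≈ z
  ≈-trans {q} {r} {z} (from-divisible q-r) (from-divisible r-z) =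
    divisible⇒≈ (solve 3 (λ q r z → (q :- r) :+ (r :- z) := q :- z) refl q r z)
      (divisible-+ q-r r-z)

  ≈-setoid : Setoid 0ℓ 0ℓ
  ≈-setoid = record
    { Carrier = ℚ
    ; _≈_ = _≈_
    ; isEquivalence = record { refl = ≈-reflexive refl ; sym = ≈-sym ; trans = ≈-trans }
    }

  module ≈-Reasoning = SetoidReasoning ≈-setoid

  +-cong : ∀ {q q′ r r′} → q ≈ q′ → r ≈ r′ → q + r ≈ q′ + r′
  +-cong {q} {q′} {r} {r′} (from-divisible q-q′) (from-divisible r-r′) =
    divisible⇒≈ (solve 4 (λ q q′ r r′ → (q :- q′) :+ (r :- r′) := (q :+ r) :- (q′ :+ r′)) refl q q′ r r′)
      (divisible-+ q-q′ r-r′)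

  neg-cong : ∀ {q r} → q ≈ r → - q ≈ - r
  neg-cong {q} {r} (from-divisible q-r) =
    divisible⇒≈ (solve 2 (λ q r → :- (q :- r) := (:- q) :- (:- r)) refl q r) (divisible-neg q-r)

  *-congʳ : ∀ {c q r} → Integral c → q ≈ r → q * c ≈ r * c
  *-congʳ {c} {q} {r} ic (from-divisible q-r) =
    divisible⇒≈ (solve 3 (λ c q r → (q :- r) :* c := q :* c :- r :* c) refl c q r)
      (divisible-*ʳ q-r ic)

  *-congˡ : ∀ {c q r} → Integral c → q ≈ r → c * q ≈ c * r
  *-congˡ {c} {q} {r} ic (from-divisible q-r) =
    divisible⇒≈ (solve 3 (λ c q r → (q :- r) :* c := c :* q :- c :* r) refl c q r)
      (divisible-*ʳ q-r ic)

  divisible-≈ : ∀ {q r} → q ≈ r → Divisible r → Divisible q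
  divisible-≈ {q} {r} (from-divisible q-r) dr =
    subst Divisible (solve 2 (λ q r → (q :- r) :+ r := q) refl q r) (divisible-+ q-r dr)

  ≉0⇒≢0 : ∀ {q} → ¬ Divisible q → q ≢ 0ℚ
  ≉0⇒≢0 q≉0 refl = q≉0 divisible-0

  *-cancelˡ-≈ : ∀ {u q r} → Unit u → Integral q → Integral r → u * q ≈ u * r → q ≈ r
  *-cancelˡ-≈ {u} {q} {r} (iu , u≉0) iq ir (from-divisible uq-ur) =
    from-divisible (fromInj₂ (⊥-elim ∘ u≉0) (divisible-*-split iu (integral-+ iq (integral-neg ir)) u[q-r]))
    where
    u[q-r] : Divisible (u * (q - r))
    u[q-r] = subst Divisible (solve 3 (λ u q r → u :* q :- u :* r := u :* (q :- r)) refl u q r) uq-ur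

  ι-≈ : ∀ m n → + p ℤD.∣ m ℤ.- n → ι m ≈ ι n
  ι-≈ m n p∣m-n = divisible⇒≈ (trans (ι-+ m (ℤ.- n)) (cong (_+_ (ι m)) (ι-neg n)))
                                   (divisible-ι⁻ (m ℤ.- n) (ℤS.∣ᵤ⇒∣ p∣m-n))

  unit-* : ∀ {q r} → Unit q → Unit r → Unit (q * r)
  unit-* (iq , q≉0) (ir , r≉0) = integral-* iq ir , [ q≉0 , r≉0 ]′ ∘ divisible-*-split iq ir

  unit-1 : Unit 1ℚ
  unit-1 = integral p∤1 , p∤1 ∘ ℤS.∣⇒∣ᵤ ∘ p∣↥

  unit-factorˡ : ∀ {q z c} → Integral q → Integral z → Unit c → q * z ≈ c → Unit q
  unit-factorˡ iq iz (_ , c≉0) qz≈c = iq , λ dq → c≉0 (divisible-≈ (≈-sym qz≈c) (divisible-*ʳ dq iz))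

  inverse-unique : ∀ {u z z′} → Integral z → Integral z′ → u * z ≈ 1ℚ → u * z′ ≈ 1ℚ → z ≈ z′
  inverse-unique {u} {z} {z′} iz iz′ uz≈1 uz′≈1 = begin
    z            ≡⟨ ℚP.*-identityˡ z ⟨
    1ℚ * z       ≈⟨ *-congʳ iz uz′≈1 ⟨
    u * z′ * z   ≡⟨ solve 3 (λ u z z′ → u :* z′ :* z := u :* z :* z′) refl u z z′ ⟩
    u * z * z′   ≈⟨ *-congʳ iz′ uz≈1 ⟩
    1ℚ * z′      ≡⟨ ℚP.*-identityˡ z′ ⟩
    z′           ∎
    where open ≈-Reasoning

  ⊘-≈-inverse : ∀ {q r u} → Unit q → Unit r → Integral u → q ≈ r * u →
                Integral (r ⊘ q) × u * (r ⊘ q) ≈ 1ℚ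
  ⊘-≈-inverse {q} {r} {u} (iq , q≉0) r-unit@(ir , _) iu q≈ru =
    iz , *-cancelˡ-≈ r-unit (integral-* iu iz) (proj₁ unit-1) r[uz]≈r1
    where
    z : ℚ
    z = r ⊘ q
    qz≡r : q * z ≡ r
    qz≡r = trans (ℚP.*-comm q z) (⊘-inverseʳ r (≉0⇒≢0 q≉0))
    iz : Integral z
    iz = integral-cancelˡ q≉0 (subst Integral (sym qz≡r) ir)
    r[uz]≈r1 : r * (u * z) ≈ r * 1ℚ
    r[uz]≈r1 = begin
      r * (u * z)  ≡⟨ ℚP.*-assoc r u z ⟨
      r * u * z    ≈⟨ *-congʳ iz q≈ru ⟨
      q * z        ≡⟨ qz≡r ⟩
      r            ≡⟨ ℚP.*-identityʳ r ⟨
      r * 1ℚ       ∎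
      where open ≈-Reasoning

  divisible⇒multiple : ∀ {q} → Divisible q → ∃ λ q′ → Integral q′ × q ≡ ι (+ p) * q′
  divisible⇒multiple {q@(ℚ.mkℚ n m-1 _)} dq@(divisible (ℤS.divides k n≡kp)) =
    q′ , integral-≃ q′≃k/m (p∤↧ (divisible⇒integral dq)) , ℚP.toℚᵘ-injective (begin
      toℚᵘ q                      ≈⟨ *≡* n[1*m]≡[pk]m ⟩
      mkℚᵘ (+ p) 0 ℚᵘ.* mkℚᵘ k m-1  ≈⟨ ℚᵘP.*-cong (toℚᵘ-ι (+ p)) q′≃k/m ⟨
      toℚᵘ (ι (+ p)) ℚᵘ.* toℚᵘ q′    ≈⟨ ℚP.toℚᵘ-homo-* (ι (+ p)) q′ ⟨
      toℚᵘ (ι (+ p) * q′)            ∎)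
    where
    open ℚᵘP.≃-Reasoning
    q′ : ℚ
    q′ = ℚ.fromℚᵘ (mkℚᵘ k m-1)
    q′≃k/m : toℚᵘ q′ ≃ mkℚᵘ k m-1
    q′≃k/m = ℚP.toℚᵘ-fromℚᵘ (mkℚᵘ k m-1)
    n[1*m]≡[pk]m : n ℤ.* + (1 ℕ.* suc m-1) ≡ (+ p ℤ.* k) ℤ.* + suc m-1
    n[1*m]≡[pk]m = cong₂ ℤ._*_ (trans n≡kp (ℤP.*-comm k (+ p))) (cong +_ (ℕP.*-identityˡ (suc m-1)))

  ι[p]≢0 : ι (+ p) ≢ 0ℚ
  ι[p]≢0 ι[p]≡0 with ℚᵘP.≃-trans (ℚᵘP.≃-sym (toℚᵘ-ι (+ p))) (ℚP.toℚᵘ-cong ι[p]≡0)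
  ... | *≡* p*1≡0 =
    ℕ.≢-nonZero⁻¹ p {{prime⇒nonZero p-prime}} (ℤP.+-injective (trans (sym (ℤP.*-identityʳ (+ p))) p*1≡0))

  -- p ∣ q, r forces p² ∣ q² + c r², which is incompatible with p ∤ a′.
  p∣a′-of-norm : ∀ {a′ c q r} → Integral c → Divisible q → Divisible r →
                 ι a′ * ι (+ p) ≡ q * q + c * r * r → + p ℤS.∣ a′
  p∣a′-of-norm {a′} {c} ic dq dr norm with divisible⇒multiple dq | divisible⇒multiple dr
  ... | q′ , iq′ , refl | r′ , ir′ , refl =
    divisible-ι⁺ a′ (subst Divisible (sym a′≡πW) (divisible-*ʳ π-divisible
      (integral-+ (integral-* iq′ iq′) (integral-* (integral-* ic ir′) ir′))))
    where
    π : ℚ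
    π = ι (+ p)
    π-divisible : Divisible π
    π-divisible = divisible-ι⁻ (+ p) ℤS.∣-refl
    a′≡πW : ι a′ ≡ π * (q′ * q′ + c * r′ * r′)
    a′≡πW = *-cancelʳ-≡ π ι[p]≢0 (trans norm
      (solve 4 (λ π q′ r′ c → π :* q′ :* (π :* q′) :+ c :* (π :* r′) :* (π :* r′)
                              := π :* (q′ :* q′ :+ c :* r′ :* r′) :* π) refl π q′ r′ c))

  norm-units : ∀ {a′ c q r u} → ¬ + p ℤS.∣ a′ → Integral c → Unit u → Integral q → Integral r →
               ι a′ * ι (+ p) ≡ q * q + c * r * r → q ≈ r * u → Unit q × Unit r
  norm-units {q = q} {r} p∤a′ ic (iu , u≉0) iq ir norm q≈ru = (iq , q≉0) , (ir , r≉0)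
    where
    r≉0 : ¬ Divisible r
    r≉0 dr = p∤a′ (p∣a′-of-norm ic (divisible-≈ q≈ru (divisible-*ʳ dr iu)) dr norm)
    q≉0 : ¬ Divisible q
    q≉0 dq = [ r≉0 , u≉0 ]′ (divisible-*-split ir iu (divisible-≈ (≈-sym q≈ru) dq))

  halves : ∀ {a b s r g₁ g₂ h₁ h₂} → Integral ½ → Integral b → r * s ≈ - 1ℚ →
           a + b * s ≈ g₁ × r * (a + b * s) ≈ h₁ →
           a + (- b) * s ≈ g₂ × r * (a + (- b) * s) ≈ h₂ →
           a ≈ ½ * (g₁ + g₂) × b ≈ ½ * (h₂ - h₁)
  halves {a} {b} {s} {r} {g₁} {g₂} {h₁} {h₂} i½ ib rs≈-1 (a+bs≈g₁ , r[a+bs]≈h₁) (a-bs≈g₂ , r[a-bs]≈h₂) =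
    a≈ , b≈
    where
    open ≈-Reasoning
    a≈ : a ≈ ½ * (g₁ + g₂)
    a≈ = begin
      a                                   ≡⟨ solve 3 (λ a b s → a := con ½ :* ((a :+ b :* s) :+ (a :+ (:- b) :* s))) refl a b s ⟩
      ½ * ((a + b * s) + (a + (- b) * s)) ≈⟨ *-congˡ i½ (+-cong a+bs≈g₁ a-bs≈g₂) ⟩
      ½ * (g₁ + g₂)                       ∎
    b≈ : b ≈ ½ * (h₂ - h₁)
    b≈ = begin
      b                                   ≡⟨ solve 1 (λ b → b := con (- 1ℚ) :* (:- b)) refl b ⟩
      - 1ℚ * (- b)                        ≈⟨ *-congʳ (integral-neg ib) rs≈-1 ⟨
      r * s * (- b)                       ≡⟨ solve 4 (λ a b s r → r :* s :* (:- b)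
                                                := con ½ :* (r :* (a :+ (:- b) :* s) :- r :* (a :+ b :* s))) refl a b s r ⟩
      ½ * (r * (a + (- b) * s) - r * (a + b * s)) ≈⟨ *-congˡ i½ (+-cong r[a-bs]≈h₂ (neg-cong r[a+bs]≈h₁)) ⟩
      ½ * (h₂ - h₁)                       ∎

module QuadraticField (d : ℕ) where
  open Field d

  mkE-cong : ∀ {a b c e a′ b′ c′ e′} → a ≡ a′ → b ≡ b′ → c ≡ c′ → e ≡ e′ →
             mkE a b c e ≡ mkE a′ b′ c′ e′
  mkE-cong refl refl refl refl = refl

  fromF-· : ∀ a b a′ b′ → fromF a b · fromF a′ b′ ≡ fromF (a * a′ + δ * b * b′) (a * b′ + b * a′)
  fromF-· a b a′ b′ = mkE-cong
    (solve 5 (λ a b a′ b′ δ → a :* a′ :+ δ :* b :* b′ :- con 0ℚ :* con 0ℚ :- δ :* con 0ℚ :* con 0ℚ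
                              := a :* a′ :+ δ :* b :* b′) refl a b a′ b′ δ)
    (solve 4 (λ a b a′ b′ → a :* b′ :+ b :* a′ :- con 0ℚ :* con 0ℚ :- con 0ℚ :* con 0ℚ
                            := a :* b′ :+ b :* a′) refl a b a′ b′)
    (solve 5 (λ a b a′ b′ δ → a :* con 0ℚ :+ con 0ℚ :* a′ :+ δ :* b :* con 0ℚ :+ δ :* con 0ℚ :* b′
                              := con 0ℚ) refl a b a′ b′ δ)
    (solve 4 (λ a b a′ b′ → a :* con 0ℚ :+ con 0ℚ :* a′ :+ b :* con 0ℚ :+ con 0ℚ :* b′
                            := con 0ℚ) refl a b a′ b′)

  pow-coeffs : ℚ → ℚ → ℕ → ℚ × ℚ
  pow-coeffs x y zero    = 1ℚ , 0ℚ
  pow-coeffs x y (suc n) = x * a + δ * y * b , x * b + y * a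
    where
    a b : ℚ
    a = proj₁ (pow-coeffs x y n)
    b = proj₂ (pow-coeffs x y n)

  fromF-^ : ∀ x y n → fromF x y ^ n ≡ fromF (proj₁ (pow-coeffs x y n)) (proj₂ (pow-coeffs x y n))
  fromF-^ x y zero    = refl
  fromF-^ x y (suc n) = trans (cong (fromF x y ·_) (fromF-^ x y n)) (fromF-· x y _ _)

  fromF-conj-^ : ∀ x y n → fromF x (- y) ^ n ≡ fromF (proj₁ (pow-coeffs x y n)) (- proj₂ (pow-coeffs x y n))
  fromF-conj-^ x y zero    = refl
  fromF-conj-^ x y (suc n) = begin
    fromF x (- y) · (fromF x (- y) ^ n)                ≡⟨ cong (fromF x (- y) ·_) (fromF-conj-^ x y n) ⟩
    fromF x (- y) · fromF a (- b)                       ≡⟨ fromF-· x (- y) a (- b) ⟩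
    fromF (x * a + δ * (- y) * (- b)) (x * (- b) + (- y) * a) ≡⟨ cong₂ fromF
      (solve 5 (λ x y a b δ → x :* a :+ δ :* (:- y) :* (:- b) := x :* a :+ δ :* y :* b) refl x y a b δ)
      (solve 4 (λ x y a b → x :* (:- b) :+ (:- y) :* a := :- (x :* b :+ y :* a)) refl x y a b) ⟩
    fromF (x * a + δ * y * b) (- (x * b + y * a))       ∎
    where
    open ≡-Reasoning
    a b : ℚ
    a = proj₁ (pow-coeffs x y n)
    b = proj₂ (pow-coeffs x y n)

  reduce : ∀ {p} → PrimeAbove p → E → ℚ
  reduce (prime𝔓 s t _ _) (mkE a b c e) = a + b * ι s + c * ι t + e * ι s * ι t

  reduce-cong : ∀ {p} (𝔓 : PrimeAbove p) z z′ → z ≡ z′ [mod𝔓 𝔓 ] → reduce 𝔓 z ≡ reduce 𝔓 z′ [modℚ p ]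
  reduce-cong {p} (prime𝔓 s t _ _) (mkE a b c e) (mkE a′ b′ c′ e′) =
    subst (λ q → + p ℤD.∣ ↥ q)
      (solve 10 (λ a b c e a′ b′ c′ e′ s t →
          (a :- a′) :+ (b :- b′) :* s :+ (c :- c′) :* t :+ (e :- e′) :* s :* t :- con 0ℚ
          := (a :+ b :* s :+ c :* t :+ e :* s :* t) :- (a′ :+ b′ :* s :+ c′ :* t :+ e′ :* s :* t))
        refl a b c e a′ b′ c′ e′ (ι s) (ι t))

module _ {p : ℕ} (p-prime : Prime p) where
  open Localisation p-prime

  module Reduction {d : ℕ} (p∤d : ¬ + p ℤS.∣ + d) (𝔓 : Field.PrimeAbove d p) where
    open Field d
    open QuadraticField d
    open PrimeAbove 𝔓 renaming (s to s₀; t to t₀)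

    s t : ℚ
    s = ι s₀
    t = ι t₀

    δ-unit : Unit δ
    δ-unit = integral-ι (+ d) , p∤d ∘ divisible-ι⁺ (+ d)

    t-inverse : t * (- t) ≈ 1ℚ
    t-inverse = begin
      t * (- t)         ≡⟨ ℚP.neg-distribʳ-* t t ⟨
      - (t * t)         ≡⟨ cong -_ (ι-* t₀ t₀) ⟨
      - ι (t₀ ℤ.* t₀)   ≈⟨ neg-cong (ι-≈ (t₀ ℤ.* t₀) (ℤ.- + 1) t²≡-1) ⟩
      - (- 1ℚ)          ≡⟨⟩
      1ℚ                ∎
      where open ≈-Reasoning

    s-unit : Unit s
    s-unit = unit-factorˡ (integral-ι s₀) (integral-ι s₀) δ-unit
      (≈-trans (≈-reflexive (sym (ι-* s₀ s₀))) (ι-≈ (s₀ ℤ.* s₀) (+ d) s²≡d))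

    t-unit : Unit t
    t-unit = unit-factorˡ (integral-ι t₀) (integral-neg (integral-ι t₀)) unit-1 t-inverse

    reduce-≈ : ∀ z z′ → z ≡ z′ [mod𝔓 𝔓 ] → reduce 𝔓 z ≈ reduce 𝔓 z′
    reduce-≈ z z′ = modℚ⇒≈ ∘ reduce-cong 𝔓 z z′

    reduce-fromF : ∀ a b → reduce 𝔓 (fromF a b) ≡ a + b * s
    reduce-fromF a b = solve 4 (λ a b s t → a :+ b :* s :+ con 0ℚ :* t :+ con 0ℚ :* s :* t := a :+ b :* s) refl a b s t

    reduce-·i : ∀ α → reduce 𝔓 (α ·i) ≡ α * t
    reduce-·i α = solve 3 (λ α s t → con 0ℚ :+ con 0ℚ :* s :+ α :* t :+ con 0ℚ :* s :* t := α :* t) refl α s t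

    X≈Y√di : ∀ X Y → mkE X 0ℚ 0ℚ (- Y) ≡ mkE 0ℚ 0ℚ 0ℚ 0ℚ [mod𝔓 𝔓 ] → X ≈ Y * (s * t)
    X≈Y√di X Y X-Y√di≡0 = begin
      X                                           ≡⟨ solve 4 (λ X Y s t →
          X := (X :+ con 0ℚ :* s :+ con 0ℚ :* t :+ (:- Y) :* s :* t) :+ Y :* (s :* t)) refl X Y s t ⟩
      reduce 𝔓 (mkE X 0ℚ 0ℚ (- Y)) + Y * (s * t)  ≈⟨ +-cong {r = Y * (s * t)}
          (reduce-≈ (mkE X 0ℚ 0ℚ (- Y)) (mkE 0ℚ 0ℚ 0ℚ 0ℚ) X-Y√di≡0) (≈-reflexive refl) ⟩
      reduce 𝔓 (mkE 0ℚ 0ℚ 0ℚ 0ℚ) + Y * (s * t)    ≡⟨ solve 3 (λ Y s t →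
          (con 0ℚ :+ con 0ℚ :* s :+ con 0ℚ :* t :+ con 0ℚ :* s :* t) :+ Y :* (s :* t) := Y :* (s :* t)) refl Y s t ⟩
      Y * (s * t)                                 ∎
      where open ≈-Reasoning

    U≈Vi : ∀ U V → mkE U 0ℚ (- V) 0ℚ ≡ mkE 0ℚ 0ℚ 0ℚ 0ℚ [mod𝔓 𝔓 ] → U ≈ V * t
    U≈Vi U V U-Vi≡0 = begin
      U                                     ≡⟨ solve 4 (λ U V s t →
          U := (U :+ con 0ℚ :* s :+ (:- V) :* t :+ con 0ℚ :* s :* t) :+ V :* t) refl U V s t ⟩
      reduce 𝔓 (mkE U 0ℚ (- V) 0ℚ) + V * t  ≈⟨ +-cong {r = V * t}
          (reduce-≈ (mkE U 0ℚ (- V) 0ℚ) (mkE 0ℚ 0ℚ 0ℚ 0ℚ) U-Vi≡0) (≈-reflexive refl) ⟩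
      reduce 𝔓 (mkE 0ℚ 0ℚ 0ℚ 0ℚ) + V * t    ≡⟨ solve 3 (λ V s t →
          (con 0ℚ :+ con 0ℚ :* s :+ con 0ℚ :* t :+ con 0ℚ :* s :* t) :+ V :* t := V :* t) refl V s t ⟩
      V * t                                 ∎
      where open ≈-Reasoning

    algebraic-integral : ∀ {x y} → Integral ½ → IsAlgIntF x y → Integral x × Integral y
    algebraic-integral {x} {y} i½ (2x-int , norm-int) = ix , integral-of-square iyy
      where
      ix : Integral x
      ix = subst Integral (solve 1 (λ x → con ½ :* (x :+ x) := x) refl x)
             (integral-* {r = x + x} i½ (isInt⇒integral 2x-int))
      iyy : Integral (y * y)
      iyy = integral-cancelˡ (proj₂ δ-unit)
              (subst Integral (solve 3 (λ x y δ → x :* x :- (x :* x :- δ :* y :* y) := δ :* (y :* y)) refl x y δ)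
                (integral-+ (integral-* ix ix) (integral-neg {x * x - δ * y * y} (isInt⇒integral norm-int))))

    pow-coeffs-integral : ∀ {x y} → Integral x → Integral y → ∀ n →
                          Integral (proj₁ (pow-coeffs x y n)) × Integral (proj₂ (pow-coeffs x y n))
    pow-coeffs-integral ix iy zero    = integral p∤1 , divisible⇒integral divisible-0
    pow-coeffs-integral {x} {y} ix iy (suc n) =
      integral-+ (integral-* ix ia) (integral-* (integral-* (proj₁ δ-unit) iy) ib) ,
      integral-+ (integral-* ix ib) (integral-* iy ia)
      where
      ia : Integral (proj₁ (pow-coeffs x y n))
      ia = proj₁ (pow-coeffs-integral ix iy n)
      ib : Integral (proj₂ (pow-coeffs x y n))
      ib = proj₂ (pow-coeffs-integral ix iy n)

    module Quotients {a′ : ℤ} (p∤a′ : ¬ + p ℤS.∣ a′) {X Y U V : ℚ}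
                     (iX : Integral X) (iY : Integral Y) (iU : Integral U) (iV : Integral V)
                     (XY-norm : ι a′ * ι (+ p) ≡ X * X + δ * Y * Y)
                     (UV-norm : ι a′ * ι (+ p) ≡ U * U + V * V)
                     (X≈Y[st] : X ≈ Y * (s * t)) (U≈Vt : U ≈ V * t) where

      r v w : ℚ
      r = (Y * V) ⊘ (X * U)
      v = V ⊘ U
      w = Y ⊘ X

      private
        is : Integral s
        is = proj₁ s-unit
        it : Integral t
        it = proj₁ t-unit
        XY-units : Unit X × Unit Y
        XY-units = norm-units p∤a′ (proj₁ δ-unit) (unit-* s-unit t-unit) iX iY XY-norm X≈Y[st]
        UV-units : Unit U × Unit V
        UV-units = norm-units p∤a′ (proj₁ unit-1) t-unit iU iV
                     (trans UV-norm (cong (_+_ (U * U)) (sym (cong (_* V) (ℚP.*-identityˡ V))))) U≈Vt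
        w-inverse : Integral w × s * t * w ≈ 1ℚ
        w-inverse = ⊘-≈-inverse (proj₁ XY-units) (proj₂ XY-units) (integral-* is it) X≈Y[st]
        v-inverse : Integral v × t * v ≈ 1ℚ
        v-inverse = ⊘-≈-inverse (proj₁ UV-units) (proj₂ UV-units) it U≈Vt
        iw : Integral w
        iw = proj₁ w-inverse
        iv : Integral v
        iv = proj₁ v-inverse

      v≈-t : v ≈ - t
      v≈-t = inverse-unique {u = t} iv (integral-neg it) (proj₂ v-inverse) t-inverse

      sw≈-t : s * w ≈ - t
      sw≈-t = inverse-unique {u = t} (integral-* is iw) (integral-neg it)
        (≈-trans (≈-reflexive (solve 3 (λ s t w → t :* (s :* w) := s :* t :* w) refl s t w)) (proj₂ w-inverse))
        t-inverse

      r≡wv : r ≡ w * v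
      r≡wv = sym (⊘-unique XU≢0 (begin
        w * v * (X * U)    ≡⟨ solve 4 (λ w v X U → w :* v :* (X :* U) := (w :* X) :* (v :* U)) refl w v X U ⟩
        (w * X) * (v * U)  ≡⟨ cong₂ _*_ (⊘-inverseʳ Y (≉0⇒≢0 (proj₂ (proj₁ XY-units))))
                                        (⊘-inverseʳ V (≉0⇒≢0 (proj₂ (proj₁ UV-units)))) ⟩
        Y * V              ∎))
        where
        open ≡-Reasoning
        XU≢0 : X * U ≢ 0ℚ
        XU≢0 = ≉0⇒≢0 (proj₂ (unit-* (proj₁ XY-units) (proj₁ UV-units)))

      ir : Integral r
      ir = subst Integral (sym r≡wv) (integral-* iw iv)

      rs≈-1 : r * s ≈ - 1ℚ
      rs≈-1 = begin
        r * s            ≡⟨ trans (cong (_* s) r≡wv) (solve 3 (λ w v s → w :* v :* s := (s :* w) :* v) refl w v s) ⟩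
        (s * w) * v      ≈⟨ *-congʳ iv sw≈-t ⟩
        (- t) * v        ≈⟨ *-congˡ (integral-neg it) v≈-t ⟩
        (- t) * (- t)    ≡⟨ ℚP.neg-distribˡ-* t (- t) ⟨
        - (t * (- t))    ≈⟨ neg-cong t-inverse ⟩
        - 1ℚ             ∎
        where open ≈-Reasoning

      rt≈w : r * t ≈ w
      rt≈w = begin
        r * t            ≡⟨ trans (cong (_* t) r≡wv) (solve 3 (λ w v t → w :* v :* t := w :* (t :* v)) refl w v t) ⟩
        w * (t * v)      ≈⟨ *-congˡ iw (proj₂ v-inverse) ⟩
        w * 1ℚ           ≡⟨ ℚP.*-identityʳ w ⟩
        w                ∎
        where open ≈-Reasoning

      -- g and h are what z contributes to the 1- and √d-coordinates of the formulas.
      Reads : ℚ → ℚ → ℚ → Set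
      Reads z g h = z ≈ g × r * z ≈ h

      reads-≈ : ∀ {z z′ g h} → z ≈ z′ → Reads z′ g h → Reads z g h
      reads-≈ z≈z′ (z′≈g , rz′≈h) = ≈-trans z≈z′ z′≈g , ≈-trans (*-congˡ ir z≈z′) rz′≈h

      reads-real : ∀ {η α} → η ≡ fromF α 0ℚ → Reads (reduce 𝔓 η) α (r * α)
      reads-real {α = α} refl = reads-≈ (≈-reflexive ηₚ≡α) (≈-reflexive refl , ≈-reflexive refl)
        where
        ηₚ≡α : reduce 𝔓 (fromF α 0ℚ) ≡ α
        ηₚ≡α = trans (reduce-fromF α 0ℚ) (solve 2 (λ α s → α :+ con 0ℚ :* s := α) refl α s)

      reads-imag : ∀ {η α} → Integral α → η ≡ α ·i → Reads (reduce 𝔓 η) (- (v * α)) (w * α)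
      reads-imag {α = α} iα refl = reads-≈ (≈-reflexive (reduce-·i α)) (αt≈-vα , r[αt]≈wα)
        where
        open ≈-Reasoning
        αt≈-vα : α * t ≈ - (v * α)
        αt≈-vα = begin
          α * t          ≡⟨ solve 2 (λ α t → α :* t := :- (α :* (:- t))) refl α t ⟩
          - (α * (- t))  ≈⟨ neg-cong (*-congˡ iα v≈-t) ⟨
          - (α * v)      ≡⟨ cong -_ (ℚP.*-comm α v) ⟩
          - (v * α)      ∎
        r[αt]≈wα : r * (α * t) ≈ w * α
        r[αt]≈wα = begin
          r * (α * t)    ≡⟨ solve 3 (λ r α t → r :* (α :* t) := α :* (r :* t)) refl r α t ⟩
          α * (r * t)    ≈⟨ *-congˡ iα rt≈w ⟩
          α * w          ≡⟨ ℚP.*-comm α w ⟩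
          w * α          ∎

      power-≡ₚ : ∀ {x y} k {η η′ g₁ h₁ g₂ h₂} → Integral ½ → IsAlgIntF x y →
                 (fromF x y ^ k) ≡ η [mod𝔓 𝔓 ] → (fromF x (- y) ^ k) ≡ η′ [mod𝔓 𝔓 ] →
                 Reads (reduce 𝔓 η) g₁ h₁ → Reads (reduce 𝔓 η′) g₂ h₂ →
                 (fromF x y ^ k) ≡ₚ fromF (½ * (g₁ + g₂)) (½ * (h₂ - h₁)) [mod p ]
      power-≡ₚ {x} {y} k {η} {η′} {g₁} {h₁} {g₂} {h₂} i½ x+y√d-integral εᵏ≡η ε̄ᵏ≡η′ η-reads η′-reads =
        subst (λ z → z ≡ₚ fromF (½ * (g₁ + g₂)) (½ * (h₂ - h₁)) [mod p ]) (sym (fromF-^ x y k))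
          (≈⇒modℚ (proj₁ ab≈) , ≈⇒modℚ (proj₂ ab≈) ,
           ≈⇒modℚ (≈-reflexive {0ℚ} refl) , ≈⇒modℚ (≈-reflexive {0ℚ} refl))
        where
        a b : ℚ
        a = proj₁ (pow-coeffs x y k)
        b = proj₂ (pow-coeffs x y k)

        ib : Integral b
        ib = proj₂ (pow-coeffs-integral (proj₁ x,y-integral) (proj₂ x,y-integral) k)
          where
          x,y-integral : Integral x × Integral y
          x,y-integral = algebraic-integral i½ x+y√d-integral

        a+bs≈η : a + b * s ≈ reduce 𝔓 η
        a+bs≈η = ≈-trans (≈-reflexive (sym (trans (cong (reduce 𝔓) (fromF-^ x y k)) (reduce-fromF a b))))
                         (reduce-≈ (fromF x y ^ k) η εᵏ≡η)

        a-bs≈η′ : a + (- b) * s ≈ reduce 𝔓 η′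
        a-bs≈η′ = ≈-trans (≈-reflexive (sym (trans (cong (reduce 𝔓) (fromF-conj-^ x y k)) (reduce-fromF a (- b)))))
                          (reduce-≈ (fromF x (- y) ^ k) η′ ε̄ᵏ≡η′)

        ab≈ : a ≈ ½ * (g₁ + g₂) × b ≈ ½ * (h₂ - h₁)
        ab≈ = halves {a} {b} {s} {r} i½ ib rs≈-1 (reads-≈ a+bs≈η η-reads) (reads-≈ a-bs≈η′ η′-reads)

lemma3p1 : (d : ℕ) → d > 1 → SquareFree d →
  let open Field d in
  (x y : ℚ) → IsAlgIntF x y →
  (a' : ℤ) → a' ≢ + 0 →
  (p : ℕ) → Prime p → p > 2 → ¬ ((+ p) ℤD.∣ (a' ℤ.* + d)) →
  LegendreOne (+ d) p → LegendreOne (ℤ.- + 1) p →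
  (X Y U V : ℚ) →
  PIntegral p X → PIntegral p Y → PIntegral p U → PIntegral p V →
  ι a' * ι (+ p) ≡ X * X + δ * Y * Y →
  ι a' * ι (+ p) ≡ U * U + V * V →
  (𝔓 : PrimeAbove p) →
  mkE X 0ℚ 0ℚ (- Y) ≡ mkE 0ℚ 0ℚ 0ℚ 0ℚ [mod𝔓 𝔓 ] →
  mkE U 0ℚ (- V) 0ℚ ≡ mkE 0ℚ 0ℚ 0ℚ 0ℚ [mod𝔓 𝔓 ] →
  (η η' : E) → Inμ₄ η → Inμ₄ η' →
  (fromF x y ^ ((p ∸ 1) / 4)) ≡ η [mod𝔓 𝔓 ] →
  (fromF x (- y) ^ ((p ∸ 1) / 4)) ≡ η' [mod𝔓 𝔓 ] →
  (α β : ℚ) → Sign α → Sign β →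
  let k = (p ∸ 1) / 4
      εk = fromF x y ^ k
      r = (Y * V) ⊘ (X * U)
      v = V ⊘ U
      w = Y ⊘ X
  in
    (η ≡ fromF α 0ℚ → η' ≡ fromF β 0ℚ →
       εk ≡ₚ fromF (½ * (α + β)) (½ * (r * β - r * α)) [mod p ])
  × (η ≡ fromF α 0ℚ → η' ≡ β ·i →
       εk ≡ₚ fromF (½ * (α - v * β)) (½ * (w * β - r * α)) [mod p ])
  × (η ≡ α ·i → η' ≡ fromF β 0ℚ →
       εk ≡ₚ fromF (½ * (β - v * α)) (½ * (r * β - w * α)) [mod p ])
  × (η ≡ α ·i → η' ≡ β ·i →
       εk ≡ₚ fromF (½ * (- (v * α) - v * β)) (½ * (w * β - w * α)) [mod p ])
lemma3p1 d _ _ x y x+y√d-integral a′ _ p p-prime p>2 p∤a′d _ _ X Y U V iX iY iU iV XY-norm UV-norm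
  𝔓 X-Y√di≡0 U-Vi≡0 η η′ _ _ εᵏ≡η ε̄ᵏ≡η′ α β α-sign β-sign =
  (λ η≡α η′≡β → conclude (reads-real η≡α) (reads-real η′≡β)) ,
  (λ η≡α η′≡βi → conclude (reads-real η≡α) (reads-imag iβ η′≡βi)) ,
  (λ η≡αi η′≡β → subst (λ g → (fromF x y ^ k) ≡ₚ fromF (½ * g) (½ * (r * β - w * α)) [mod p ])
                       (ℚP.+-comm (- (v * α)) β)
                       (conclude (reads-imag iα η≡αi) (reads-real η′≡β))) ,
  (λ η≡αi η′≡βi → conclude (reads-imag iα η≡αi) (reads-imag iβ η′≡βi))
  where
  open Localisation p-prime
  open Field d
  open QuadraticField d using (reduce)

  p∤a′ : ¬ + p ℤS.∣ a′
  p∤a′ = p∤a′d ∘ ℤS.∣⇒∣ᵤ ∘ ℤS.∣m⇒∣m*n (+ d)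

  p∤d : ¬ + p ℤS.∣ + d
  p∤d = p∤a′d ∘ ℤS.∣⇒∣ᵤ ∘ ℤS.∣n⇒∣m*n a′

  open Reduction p-prime p∤d 𝔓
  open Quotients p∤a′ {X} {Y} {U} {V} (integral iX) (integral iY) (integral iU) (integral iV)
                 XY-norm UV-norm (X≈Y√di X Y X-Y√di≡0) (U≈Vi U V U-Vi≡0)

  iα : Integral α
  iα = sign-integral α-sign
  iβ : Integral β
  iβ = sign-integral β-sign

  k : ℕ
  k = (p ∸ 1) / 4

  conclude : ∀ {g₁ h₁ g₂ h₂} → Reads (reduce 𝔓 η) g₁ h₁ → Reads (reduce 𝔓 η′) g₂ h₂ →
             (fromF x y ^ k) ≡ₚ fromF (½ * (g₁ + g₂)) (½ * (h₂ - h₁)) [mod p ]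
  conclude = power-≡ₚ k (integral (ℕP.<⇒≱ p>2 ∘ ℕD.∣⇒≤)) x+y√d-integral εᵏ≡η ε̄ᵏ≡η′
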